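{- Let $n,\ell,u$ be integers with $n\ge \ell+u$ (and $\ell,u\ge0$). Fix $L\subseteq\{0,\dots,\ell-1\}$ and $U\subseteq\{n-u,\dots,n-1\}$. Let $R$ be a uniformly randomly chosen subset of $\{\ell,\dots,n-u-1\}$ and set $A:=L\cup R\cup U$. Then the probability that \[ \{2\ell-1,\dots,n-u-1\}\cup\{n+\ell-1,\dots,2n-2u-1\}\subseteq A+A \] is greater than $1-6(2^{ -|L|}+2^{ -|U|})$.
   Context: $A+A=\{a_1+a_2: a_1,a_2\in A\}$. "Uniformly randomly chosen subset" means each of the $2^{n-\ell-u}$ subsets is chosen with equal probability. -}

module Defs where

open import Data.Bool using (Bool; true; false; _∧_; if_then_else_)
open import Data.Nat using (ℕ; zero; suc; _+_; _*_; _∸_; _^_)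
open import Data.Nat.Properties using (m^n≢0)
open import Data.Integer using (ℤ; +_; _-_)
import Data.Integer as ℤ
open import Data.List using (List; []; _∷_; _++_; map; upTo; filterᵇ; length)
open import Data.Bool.ListAction using (any; all)
open import Data.Vec using (Vec; []; _∷_)
open import Data.Fin.Subset using (Subset)
open import Relation.Nullary.Decidable using (⌊_⌋)
open import Data.Rational using (ℚ; _/_)

elemsFrom : ∀ {k} → ℕ → Vec Bool k → List ℕ
elemsFrom off []           = []
elemsFrom off (true  ∷ s) = off ∷ elemsFrom (suc off) s
elemsFrom off (false ∷ s) = elemsFrom (suc off) s

allSubsets : (m : ℕ) → List (Vec Bool m)
allSubsets zero    = [] ∷ []
allSubsets (suc m) = map (true ∷_) (allSubsets m) ++ map (false ∷_) (allSubsets m)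

-- The set A = L ∪ R ∪ U ⊆ {0,...,n-1}, where
--   L ⊆ {0,...,ℓ-1}        is given as a subset of Fin ℓ (index i ↦ i),
--   R ⊆ {ℓ,...,n-u-1}      is given as a subset of Fin (n-ℓ-u) (index j ↦ ℓ + j),
--   U ⊆ {n-u,...,n-1}      is given as a subset of Fin u (index k ↦ n - u + k).
setA : (n ℓ u : ℕ) → Subset ℓ → Vec Bool (n ∸ ℓ ∸ u) → Subset u → List ℕ
setA n ℓ u L R U = elemsFrom 0 L ++ elemsFrom ℓ R ++ elemsFrom (n ∸ u) U

inSumset : List ℕ → ℤ → Bool
inSumset A x = any (λ a₁ → any (λ a₂ → ⌊ + (a₁ + a₂) ℤ.≟ x ⌋) A) A

-- Integer interval {lo - 1, ..., hi - 1} (given by natural lo, hi); empty if hi < lo.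
intervalZ : ℕ → ℕ → List ℤ
intervalZ lo hi = map (λ i → + (lo + i) - + 1) (upTo (suc hi ∸ lo))

target : (n ℓ u : ℕ) → List ℤ
target n ℓ u = intervalZ (2 * ℓ) (n ∸ u) ++ intervalZ (n + ℓ) (2 * (n ∸ u))

event : (n ℓ u : ℕ) → Subset ℓ → Subset u → Vec Bool (n ∸ ℓ ∸ u) → Bool
event n ℓ u L U R = all (inSumset (setA n ℓ u L R U)) (target n ℓ u)

inv2^ : ℕ → ℚ
inv2^ k = _/_ (+ 1) (2 ^ k) {{m^n≢0 2 k}}

probability : (n ℓ u : ℕ) → Subset ℓ → Subset u → ℚ
probability n ℓ u L U =
  _/_ (+ length (filterᵇ (event n ℓ u L U) (allSubsets (n ∸ ℓ ∸ u))))
      (2 ^ (n ∸ ℓ ∸ u)) {{m^n≢0 2 (n ∸ ℓ ∸ u)}}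

-- Fix a lower target t = 2ℓ - 1 + s.  If t ∉ A + A, then R contains no two elements ℓ + q, ℓ + q′
-- with q + q′ = s - 1 (for odd s this excludes the single element ℓ + (s - 1)/2), and no partner
-- t - x of an x ∈ L.  These conditions concern disjoint sets of coordinates of R, hence are
-- independent, and t ∉ A + A has probability at most 2^-|L| · 3^⌊s/2⌋ / 2^s.  The weights
-- 3^⌊s/2⌋ / 2^s sum to 6, so some lower target is missed with probability less than 6 · 2^-|L|.
-- The reflection x ↦ n - 1 - x exchanges L and U and turns upper targets into lower ones, and a
-- union bound over the two intervals finishes the proof.

module Submission where

module RandomSumset where

  open import Defs
  open import Data.Bool using (Bool; true; false; _∧_; not; T)
  open import Data.Bool.ListAction using (all; any)
  open import Data.Bool.Properties using (∧-assoc; ∧-identityʳ; T-∧; T-∨)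
  open import Data.Empty using (⊥-elim)
  open import Data.Fin.Subset using (Subset; ∣_∣)
  open import Data.Fin.Subset.Properties using (∣p∣≤n)
  open import Data.Integer using (ℤ)
  import Data.Integer as ℤ
  import Data.Integer.Properties as ℤ
  import Data.Integer.Tactic.RingSolver as ℤ
  import Data.List as List
  open import Data.List
    using (List; []; _∷_; [_]; _++_; map; filterᵇ; length; applyUpTo; applyDownFrom; upTo)
  open import Data.List.Membership.Propositional using (_∈_; _∉_)
  open import Data.List.Membership.Propositional.Properties using (∈-map⁺; ∈-map⁻; ∈-++⁺ˡ; ∈-++⁺ʳ)
  open import Data.List.Properties
    using (length-++; filter-++; map-∘; map-cong; length-map; map-++; map-upTo; reverse-applyUpTo)
  open import Data.List.Relation.Binary.Disjoint.Propositional using (Disjoint)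
  open import Data.List.Relation.Binary.Permutation.Propositional.Properties using (↭-reverse)
  open import Data.List.Relation.Unary.All using (All; []; _∷_)
  import Data.List.Relation.Unary.All as All
  import Data.List.Relation.Unary.All.Properties as All
  open import Data.List.Relation.Unary.AllPairs using (AllPairs; []; _∷_)
  import Data.List.Relation.Unary.AllPairs as AllPairs
  import Data.List.Relation.Unary.AllPairs.Properties as AllPairs
  open import Data.List.Relation.Unary.Any using (here; there)
  open import Data.List.Relation.Unary.Unique.Propositional using (Unique)
  import Data.List.Relation.Unary.Unique.Propositional.Properties as Unique
  open import Data.Nat
    using (ℕ; zero; suc; pred; _+_; _*_; _∸_; _^_; _≤_; _<_; z≤n; s≤s; ⌊_/2⌋; NonZero; _≟_)
  open import Data.Nat.ListAction using (sum; product)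
  open import Data.Nat.ListAction.Properties using (product-++; sum-↭)
  open import Data.Nat.Properties
  open import Algebra.Properties.CommutativeSemigroup +-commutativeSemigroup using (interchange)
  open import Data.Nat.Tactic.RingSolver using (solve-∀)
  open import Data.Product using (_×_; _,_; ∃; ∃₂)
  import Data.Rational as ℚ
  import Data.Rational.Properties as ℚ
  import Data.Rational.Unnormalised as ℚᵘ
  import Data.Rational.Unnormalised.Properties as ℚᵘ
  open import Data.Sum using (inj₁; inj₂)
  open import Data.Vec using (Vec; []; _∷_; _∷ʳ_; reverse)
  open import Data.Vec.Properties using (reverse-∷; reverse-involutive)
  open import Function using (_∘_)
  open import Function.Bundles using (Equivalence)
  open import Relation.Binary.PropositionalEquality hiding ([_])
  open import Relation.Nullary using (¬_; yes; no)
  open import Relation.Nullary.Decidable using (fromWitness)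

  T-not : ∀ {b} → ¬ T b → T (not b)
  T-not {false} _  = _
  T-not {true}  ¬t = ¬t _

  T-not⁻ : ∀ {b} → T (not b) → ¬ T b
  T-not⁻ {false} _ ()

  all⁺ : ∀ {A : Set} {p : A → Bool} {xs} → All (T ∘ p) xs → T (all p xs)
  all⁺ []         = _
  all⁺ (px ∷ pxs) = Equivalence.from T-∧ (px , all⁺ pxs)

  all⁻ : ∀ {A : Set} {p : A → Bool} xs → T (all p xs) → All (T ∘ p) xs
  all⁻ []       _ = []
  all⁻ (x ∷ xs) t = let px , pxs = Equivalence.to T-∧ t in px ∷ all⁻ xs pxs

  any⁺ : ∀ {A : Set} {p : A → Bool} {x xs} → x ∈ xs → T (p x) → T (any p xs)
  any⁺ (here refl) px = Equivalence.from T-∨ (inj₁ px)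
  any⁺ (there x∈xs) px = Equivalence.from T-∨ (inj₂ (any⁺ x∈xs px))

  -- Counting subsets

  count : (m : ℕ) → (Vec Bool m → Bool) → ℕ
  count m P = length (filterᵇ P (allSubsets m))

  length-filterᵇ-map : ∀ {A B : Set} (P : B → Bool) (f : A → B) xs →
    length (filterᵇ P (map f xs)) ≡ length (filterᵇ (P ∘ f) xs)
  length-filterᵇ-map P f [] = refl
  length-filterᵇ-map P f (x ∷ xs) with P (f x)
  ... | true  = cong suc (length-filterᵇ-map P f xs)
  ... | false = length-filterᵇ-map P f xs

  count-∷ : ∀ m (P : Vec Bool (suc m) → Bool) →
    count (suc m) P ≡ count m (P ∘ (true ∷_)) + count m (P ∘ (false ∷_))
  count-∷ m P = begin
    length (filterᵇ P (ts ++ fs))                       ≡⟨ cong length (filter-++ _ ts fs) ⟩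
    length (filterᵇ P ts ++ filterᵇ P fs)               ≡⟨ length-++ (filterᵇ P ts) ⟩
    length (filterᵇ P ts) + length (filterᵇ P fs)       ≡⟨ cong₂ _+_ (length-filterᵇ-map P _ (allSubsets m))
                                                                     (length-filterᵇ-map P _ (allSubsets m)) ⟩
    count m (P ∘ (true ∷_)) + count m (P ∘ (false ∷_))  ∎
    where
    open ≡-Reasoning
    ts = map (true ∷_) (allSubsets m)
    fs = map (false ∷_) (allSubsets m)

  count-cong : ∀ m {P Q : Vec Bool m → Bool} → (∀ R → P R ≡ Q R) → count m P ≡ count m Q
  count-cong zero {P} {Q} P≗Q with P [] | Q [] | P≗Q []
  ... | true  | .true  | refl = refl
  ... | false | .false | refl = refl
  count-cong (suc m) P≗Q = trans (count-∷ m _)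
    (trans (cong₂ _+_ (count-cong m (P≗Q ∘ (true ∷_))) (count-cong m (P≗Q ∘ (false ∷_)))) (sym (count-∷ m _)))

  count-mono : ∀ m {P Q : Vec Bool m → Bool} → (∀ R → T (P R) → T (Q R)) → count m P ≤ count m Q
  count-mono zero {P} {Q} P⇒Q with P [] | Q [] | P⇒Q []
  ... | false | _     | _ = z≤n
  ... | true  | true  | _ = ≤-refl
  ... | true  | false | f = ⊥-elim (f _)
  count-mono (suc m) P⇒Q = subst₂ _≤_ (sym (count-∷ m _)) (sym (count-∷ m _))
    (+-mono-≤ (count-mono m (P⇒Q ∘ (true ∷_))) (count-mono m (P⇒Q ∘ (false ∷_))))

  count-false : ∀ m → count m (λ _ → false) ≡ 0
  count-false zero    = refl
  count-false (suc m) = trans (count-∷ m _) (cong₂ _+_ (count-false m) (count-false m))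

  count-true : ∀ m → count m (λ _ → true) ≡ 2 ^ m
  count-true zero    = refl
  count-true (suc m) = trans (count-∷ m _)
    (trans (cong₂ _+_ (count-true m) (count-true m)) (cong (2 ^ m +_) (sym (+-identityʳ (2 ^ m)))))

  count-≤ : ∀ m (P : Vec Bool m → Bool) → count m P ≤ 2 ^ m
  count-≤ m P = ≤-trans (count-mono m (λ _ _ → _)) (≤-reflexive (count-true m))

  count-split : ∀ m (P Q : Vec Bool m → Bool) →
    count m P ≡ count m (λ R → Q R ∧ P R) + count m (λ R → not (Q R) ∧ P R)
  count-split zero P Q with P [] | Q []
  ... | false | true  = refl
  ... | false | false = refl
  ... | true  | true  = refl
  ... | true  | false = refl
  count-split (suc m) P Q = begin
    count (suc m) P
      ≡⟨ count-∷ m P ⟩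
    count m (P ∘ (true ∷_)) + count m (P ∘ (false ∷_))
      ≡⟨ cong₂ _+_ (count-split m _ (Q ∘ (true ∷_))) (count-split m _ (Q ∘ (false ∷_))) ⟩
    (a + b) + (c + d)
      ≡⟨ interchange a b c d ⟩
    (a + c) + (b + d)
      ≡⟨ cong₂ _+_ (count-∷ m _) (count-∷ m _) ⟨
    count (suc m) (λ R → Q R ∧ P R) + count (suc m) (λ R → not (Q R) ∧ P R)
      ∎
    where
    open ≡-Reasoning
    a = count m (λ R → Q (true ∷ R) ∧ P (true ∷ R))
    b = count m (λ R → not (Q (true ∷ R)) ∧ P (true ∷ R))
    c = count m (λ R → Q (false ∷ R) ∧ P (false ∷ R))
    d = count m (λ R → not (Q (false ∷ R)) ∧ P (false ∷ R))

  count-∷ʳ : ∀ m (P : Vec Bool (suc m) → Bool) →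
    count (suc m) P ≡ count m (λ R → P (R ∷ʳ true)) + count m (λ R → P (R ∷ʳ false))
  count-∷ʳ zero P = trans (count-∷ zero P)
    (cong₂ _+_ (count-cong zero {P ∘ (true ∷_)} {λ R → P (R ∷ʳ true)} λ { [] → refl })
               (count-cong zero {P ∘ (false ∷_)} {λ R → P (R ∷ʳ false)} λ { [] → refl }))
  count-∷ʳ (suc m) P = begin
    count (suc (suc m)) P                                  ≡⟨ count-∷ (suc m) P ⟩
    count (suc m) (P ∘ (true ∷_)) + count (suc m) (P ∘ (false ∷_))
      ≡⟨ cong₂ _+_ (count-∷ʳ m (P ∘ (true ∷_))) (count-∷ʳ m (P ∘ (false ∷_))) ⟩
    (a + b) + (c + d)                                      ≡⟨ interchange a b c d ⟩
    (a + c) + (b + d)                                      ≡⟨ cong₂ _+_ (count-∷ m _) (count-∷ m _) ⟨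
    count (suc m) (λ R → P (R ∷ʳ true)) + count (suc m) (λ R → P (R ∷ʳ false)) ∎
    where
    open ≡-Reasoning
    a = count m (λ R → P (true ∷ (R ∷ʳ true)))
    b = count m (λ R → P (true ∷ (R ∷ʳ false)))
    c = count m (λ R → P (false ∷ (R ∷ʳ true)))
    d = count m (λ R → P (false ∷ (R ∷ʳ false)))

  count-reverse : ∀ m (P : Vec Bool m → Bool) → count m (P ∘ reverse) ≡ count m P
  count-reverse zero    P = count-cong zero {P ∘ reverse} {P} λ { [] → refl }
  count-reverse (suc m) P = begin
    count (suc m) (P ∘ reverse)
      ≡⟨ count-∷ m _ ⟩
    count m (λ R → P (reverse (true ∷ R))) + count m (λ R → P (reverse (false ∷ R)))
      ≡⟨ cong₂ _+_ (count-cong m (cong P ∘ reverse-∷ true)) (count-cong m (cong P ∘ reverse-∷ false)) ⟩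
    count m (λ R → P (reverse R ∷ʳ true)) + count m (λ R → P (reverse R ∷ʳ false))
      ≡⟨ cong₂ _+_ (count-reverse m (λ R → P (R ∷ʳ true))) (count-reverse m (λ R → P (R ∷ʳ false))) ⟩
    count m (λ R → P (R ∷ʳ true)) + count m (λ R → P (R ∷ʳ false))
      ≡⟨ count-∷ʳ m P ⟨
    count (suc m) P
      ∎
    where open ≡-Reasoning

  count-not-∧ : ∀ m (P Q : Vec Bool m → Bool) →
    count m (λ R → not (P R ∧ Q R)) ≤ count m (not ∘ P) + count m (not ∘ Q)
  count-not-∧ m P Q = begin
    count m (λ R → not (P R ∧ Q R))
      ≡⟨ count-split m _ P ⟩
    count m (λ R → P R ∧ not (P R ∧ Q R)) + count m (λ R → not (P R) ∧ not (P R ∧ Q R))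
      ≤⟨ +-mono-≤ (count-mono m (λ R → fails-right (P R) (Q R))) (count-mono m (λ R → fails-left (P R) (Q R))) ⟩
    count m (not ∘ Q) + count m (not ∘ P)
      ≡⟨ +-comm (count m (not ∘ Q)) _ ⟩
    count m (not ∘ P) + count m (not ∘ Q)
      ∎
    where
    open ≤-Reasoning
    fails-right : ∀ p q → T (p ∧ not (p ∧ q)) → T (not q)
    fails-right true false _ = _
    fails-left : ∀ p q → T (not p ∧ not (p ∧ q)) → T (not p)
    fails-left false q _ = _

  count-complement : ∀ m (P : Vec Bool m → Bool) → count m P + count m (not ∘ P) ≡ 2 ^ m
  count-complement m P = begin
    count m P + count m (not ∘ P)
      ≡⟨ cong₂ _+_ (count-cong m (sym ∘ ∧-identityʳ ∘ P)) (count-cong m (sym ∘ ∧-identityʳ ∘ not ∘ P)) ⟩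
    count m (λ R → P R ∧ true) + count m (λ R → not (P R) ∧ true)
      ≡⟨ count-split m (λ _ → true) P ⟨
    count m (λ _ → true)
      ≡⟨ count-true m ⟩
    2 ^ m
      ∎
    where open ≡-Reasoning

  -- Independence of events on disjoint coordinates

  bit : ∀ {m} → Vec Bool m → ℕ → Bool
  bit []      _       = false
  bit (b ∷ R) zero    = b
  bit (b ∷ R) (suc c) = bit R c

  bit⇒< : ∀ {m} (R : Vec Bool m) c → T (bit R c) → c < m
  bit⇒< (b ∷ R) zero    _ = s≤s z≤n
  bit⇒< (b ∷ R) (suc c) t = s≤s (bit⇒< R c t)

  bit-∷ʳ : ∀ {m} (R : Vec Bool m) b c → c < m → bit (R ∷ʳ b) c ≡ bit R c
  bit-∷ʳ (r ∷ R) b zero    _         = refl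
  bit-∷ʳ (r ∷ R) b (suc c) (s≤s c<m) = bit-∷ʳ R b c c<m

  bit-∷ʳ-last : ∀ {m} (R : Vec Bool m) b → bit (R ∷ʳ b) m ≡ b
  bit-∷ʳ-last []      b = refl
  bit-∷ʳ-last (r ∷ R) b = bit-∷ʳ-last R b

  bit-reverse : ∀ {m} (R : Vec Bool m) c → c < m → bit (reverse R) c ≡ bit R (m ∸ suc c)
  bit-reverse {suc m} (b ∷ R) c c<1+m rewrite reverse-∷ b R with m<1+n⇒m<n∨m≡n c<1+m
  ... | inj₁ c<m  = begin
    bit (reverse R ∷ʳ b) c        ≡⟨ bit-∷ʳ (reverse R) b c c<m ⟩
    bit (reverse R) c             ≡⟨ bit-reverse R c c<m ⟩
    bit (b ∷ R) (suc (m ∸ suc c)) ≡⟨ cong (bit (b ∷ R)) (+-∸-assoc 1 c<m) ⟨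
    bit (b ∷ R) (m ∸ c)           ∎
    where open ≡-Reasoning
  ... | inj₂ refl = begin
    bit (reverse R ∷ʳ b) c        ≡⟨ bit-∷ʳ-last (reverse R) b ⟩
    b                             ≡⟨ cong (bit (b ∷ R)) (n∸n≡0 c) ⟨
    bit (b ∷ R) (c ∸ c)           ∎
    where open ≡-Reasoning

  Ignores : ∀ {m} → ℕ → (Vec Bool m → Bool) → Set
  Ignores j Q = ∀ R R′ → (∀ i → i ≢ j → bit R i ≡ bit R′ i) → Q R ≡ Q R′

  ∧-ignores : ∀ {m j} {P Q : Vec Bool m → Bool} → Ignores j P → Ignores j Q → Ignores j (λ R → P R ∧ Q R)
  ∧-ignores P-ign Q-ign R R′ agree = cong₂ _∧_ (P-ign R R′ agree) (Q-ign R R′ agree)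

  count-bit : ∀ m j (Q : Vec Bool m → Bool) → j < m → Ignores j Q →
    2 * count m (λ R → bit R j ∧ Q R) ≡ count m Q
  count-bit (suc m) zero Q _ ign = begin
    2 * count (suc m) (λ R → bit R 0 ∧ Q R)
      ≡⟨ cong (2 *_) (trans (count-∷ m _) (trans (cong (count m (Q ∘ (true ∷_)) +_) (count-false m))
                                                 (+-identityʳ _))) ⟩
    2 * count m (Q ∘ (true ∷_))
      ≡⟨ cong (count m (Q ∘ (true ∷_)) +_) (+-identityʳ _) ⟩
    count m (Q ∘ (true ∷_)) + count m (Q ∘ (true ∷_))
      ≡⟨ cong (count m (Q ∘ (true ∷_)) +_) (count-cong m λ R → ign (true ∷ R) (false ∷ R) (agree R)) ⟩
    count m (Q ∘ (true ∷_)) + count m (Q ∘ (false ∷_))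
      ≡⟨ count-∷ m Q ⟨
    count (suc m) Q
      ∎
    where
    open ≡-Reasoning
    agree : ∀ R i → i ≢ 0 → bit (true ∷ R) i ≡ bit (false ∷ R) i
    agree R zero    i≢0 = ⊥-elim (i≢0 refl)
    agree R (suc i) _   = refl
  count-bit (suc m) (suc j) Q (s≤s j<m) ign = begin
    2 * count (suc m) (λ R → bit R (suc j) ∧ Q R)
      ≡⟨ cong (2 *_) (count-∷ m _) ⟩
    2 * (count m (λ R → bit R j ∧ Q (true ∷ R)) + count m (λ R → bit R j ∧ Q (false ∷ R)))
      ≡⟨ *-distribˡ-+ 2 (count m (λ R → bit R j ∧ Q (true ∷ R))) _ ⟩
    2 * count m (λ R → bit R j ∧ Q (true ∷ R)) + 2 * count m (λ R → bit R j ∧ Q (false ∷ R))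
      ≡⟨ cong₂ _+_ (count-bit m j _ j<m (ignores-∷ true)) (count-bit m j _ j<m (ignores-∷ false)) ⟩
    count m (Q ∘ (true ∷_)) + count m (Q ∘ (false ∷_))
      ≡⟨ count-∷ m Q ⟨
    count (suc m) Q
      ∎
    where
    open ≡-Reasoning
    ignores-∷ : ∀ b → Ignores j (Q ∘ (b ∷_))
    ignores-∷ b R R′ agree = ign (b ∷ R) (b ∷ R′) λ where
      zero    _      → refl
      (suc i) i≢1+j → agree i (i≢1+j ∘ cong suc)

  hits : ∀ {m} → Vec Bool m → List ℕ → Bool
  hits R C = all (bit R) C

  avoidsAll : ∀ {m} → Vec Bool m → List (List ℕ) → Bool
  avoidsAll R Cs = all (λ C → not (hits R C)) Cs

  hits-ignores : ∀ {m j} C → j ∉ C → Ignores {m} j (λ R → hits R C)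
  hits-ignores []      j∉C R R′ agree = refl
  hits-ignores (c ∷ C) j∉C R R′ agree =
    cong₂ _∧_ (agree c (λ c≡j → j∉C (here (sym c≡j)))) (hits-ignores C (j∉C ∘ there) R R′ agree)

  avoidsAll-ignores : ∀ {m j} Cs → All (j ∉_) Cs → Ignores {m} j (λ R → avoidsAll R Cs)
  avoidsAll-ignores []       []              R R′ agree = refl
  avoidsAll-ignores (C ∷ Cs) (j∉C ∷ j∉Cs) R R′ agree =
    cong₂ (λ h a → not h ∧ a) (hits-ignores C j∉C R R′ agree) (avoidsAll-ignores Cs j∉Cs R R′ agree)

  count-hits : ∀ m C (Q : Vec Bool m → Bool) → Unique C → All (_< m) C → (∀ {j} → j ∈ C → Ignores j Q) →
    2 ^ length C * count m (λ R → hits R C ∧ Q R) ≡ count m Q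
  count-hits m []      Q _ _ _ = +-identityʳ (count m Q)
  count-hits m (j ∷ C) Q u@(_ ∷ uC) (j<m ∷ C<m) ign = begin
    2 ^ suc (length C) * count m (λ R → (bit R j ∧ hits R C) ∧ Q R)
      ≡⟨ cong (2 ^ suc (length C) *_) (count-cong m λ R → ∧-assoc (bit R j) _ _) ⟩
    2 * 2 ^ length C * count m (λ R → bit R j ∧ Q′ R)
      ≡⟨ reassoc (2 ^ length C) _ ⟩
    2 ^ length C * (2 * count m (λ R → bit R j ∧ Q′ R))
      ≡⟨ cong (2 ^ length C *_) (count-bit m j Q′ j<m Q′-ignores-j) ⟩
    2 ^ length C * count m Q′
      ≡⟨ count-hits m C Q uC C<m (ign ∘ there) ⟩
    count m Q
      ∎
    where
    open ≡-Reasoning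
    Q′ = λ R → hits R C ∧ Q R
    Q′-ignores-j : Ignores j Q′
    Q′-ignores-j = ∧-ignores (hits-ignores C (Unique.Unique[x∷xs]⇒x∉xs u)) (ign (here refl))
    reassoc : ∀ a b → 2 * a * b ≡ a * (2 * b)
    reassoc = solve-∀

  count-avoidsAll : ∀ m Cs → All Unique Cs → AllPairs Disjoint Cs → All (All (_< m)) Cs →
    product (map (λ C → 2 ^ length C) Cs) * count m (λ R → avoidsAll R Cs)
      ≡ 2 ^ m * product (map (λ C → 2 ^ length C ∸ 1) Cs)
  count-avoidsAll m []       _           _           _             =
    trans (+-identityʳ _) (trans (count-true m) (sym (*-identityʳ _)))
  count-avoidsAll m (C ∷ Cs) (uC ∷ uCs) (dC ∷ dCs) (C<m ∷ Cs<m) = begin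
    K * P * z               ≡⟨ swap K P z ⟩
    P * (K * z)             ≡⟨ cong (P *_) avoid-C ⟩
    P * ((K ∸ 1) * a)       ≡⟨ swap′ P (K ∸ 1) a ⟩
    (K ∸ 1) * (P * a)       ≡⟨ cong ((K ∸ 1) *_) (count-avoidsAll m Cs uCs dCs Cs<m) ⟩
    (K ∸ 1) * (2 ^ m * P′)  ≡⟨ swap′ (K ∸ 1) (2 ^ m) P′ ⟩
    2 ^ m * ((K ∸ 1) * P′)  ∎
    where
    open ≡-Reasoning
    K  = 2 ^ length C
    P  = product (map (λ C → 2 ^ length C) Cs)
    P′ = product (map (λ C → 2 ^ length C ∸ 1) Cs)
    a  = count m (λ R → avoidsAll R Cs)
    h  = count m (λ R → hits R C ∧ avoidsAll R Cs)
    z  = count m (λ R → not (hits R C) ∧ avoidsAll R Cs)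
    hit-C : K * h ≡ a
    hit-C = count-hits m C _ uC C<m λ j∈C →
      avoidsAll-ignores Cs (All.map (λ C∩C′≡∅ j∈C′ → C∩C′≡∅ (j∈C , j∈C′)) dC)
    avoid-C : K * z ≡ (K ∸ 1) * a
    avoid-C = begin
      K * z              ≡⟨ m+n∸n≡m (K * z) a ⟨
      K * z + a ∸ a      ≡⟨ cong (λ x → K * z + x ∸ a) hit-C ⟨
      K * z + K * h ∸ a  ≡⟨ cong (_∸ a) (*-distribˡ-+ K z h) ⟨
      K * (z + h) ∸ a    ≡⟨ cong (λ x → K * x ∸ a) (trans (count-split m _ (λ R → hits R C)) (+-comm h z)) ⟨
      K * a ∸ a          ≡⟨ cong (K * a ∸_) (*-identityˡ a) ⟨
      K * a ∸ 1 * a      ≡⟨ *-distribʳ-∸ a K 1 ⟨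
      (K ∸ 1) * a        ∎
    swap : ∀ k p x → k * p * x ≡ p * (k * x)
    swap = solve-∀
    swap′ : ∀ p k x → p * (k * x) ≡ k * (p * x)
    swap′ = solve-∀

  -- The clauses forced by a missing target

  -- The sets {q, s - 1 - q} of coordinates below s; for odd s the middle one is {(s - 1)/2}.
  palindromePairs : ℕ → List (List ℕ)
  palindromePairs zero          = []
  palindromePairs (suc zero)    = [ [ 0 ] ]
  palindromePairs (suc (suc s)) = (0 ∷ suc s ∷ []) ∷ map (map suc) (palindromePairs s)

  palindromePairs-< : ∀ s → All (All (_< s)) (palindromePairs s)
  palindromePairs-< zero          = []
  palindromePairs-< (suc zero)    = (s≤s z≤n ∷ []) ∷ []
  palindromePairs-< (suc (suc s)) = (s≤s z≤n ∷ ≤-refl ∷ []) ∷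
    All.map⁺ (All.map (All.map⁺ ∘ All.map (λ c<s → s≤s (m<n⇒m<1+n c<s))) (palindromePairs-< s))

  palindromePairs-unique : ∀ s → All Unique (palindromePairs s)
  palindromePairs-unique zero          = []
  palindromePairs-unique (suc zero)    = ([] ∷ []) ∷ []
  palindromePairs-unique (suc (suc s)) = (((λ ()) ∷ []) ∷ [] ∷ []) ∷
    All.map⁺ (All.map (Unique.map⁺ suc-injective) (palindromePairs-unique s))

  palindromePairs-disjoint : ∀ s → AllPairs Disjoint (palindromePairs s)
  palindromePairs-disjoint zero          = []
  palindromePairs-disjoint (suc zero)    = [] ∷ []
  palindromePairs-disjoint (suc (suc s)) =
    All.map⁺ (All.map outer-disjoint (palindromePairs-< s)) ∷
    AllPairs.map⁺ (AllPairs.map shift-disjoint (palindromePairs-disjoint s))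
    where
    outer-disjoint : ∀ {C} → All (_< s) C → Disjoint (0 ∷ suc s ∷ []) (map suc C)
    outer-disjoint C<s (v∈outer , v∈sucC) with ∈-map⁻ suc v∈sucC
    ... | c , c∈C , refl with v∈outer
    ...   | here ()
    ...   | there (here 1+c≡1+s) = <-irrefl (suc-injective 1+c≡1+s) (All.lookup C<s c∈C)
    shift-disjoint : ∀ {C C′} → Disjoint C C′ → Disjoint (map suc C) (map suc C′)
    shift-disjoint C∩C′≡∅ (v∈sucC , v∈sucC′) with ∈-map⁻ suc v∈sucC | ∈-map⁻ suc v∈sucC′
    ... | c , c∈C , refl | c′ , c′∈C′ , 1+c≡1+c′ rewrite suc-injective 1+c≡1+c′ =
      C∩C′≡∅ (c∈C , c′∈C′)

  palindromePairs-sum : ∀ s {C} → C ∈ palindromePairs s →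
    ∃₂ λ q q′ → q ∈ C × q′ ∈ C × suc (q + q′) ≡ s
  palindromePairs-sum (suc zero)    (here refl) = 0 , 0 , here refl , here refl , refl
  palindromePairs-sum (suc (suc s)) (here refl) = 0 , suc s , here refl , there (here refl) , refl
  palindromePairs-sum (suc (suc s)) (there C∈shifted) with ∈-map⁻ (map suc) C∈shifted
  ... | C , C∈pairs , refl with palindromePairs-sum s C∈pairs
  ...   | q , q′ , q∈C , q′∈C , 1+q+q′≡s =
    suc q , suc q′ , ∈-map⁺ suc q∈C , ∈-map⁺ suc q′∈C , cong (suc ∘ suc) (trans (+-suc q q′) 1+q+q′≡s)

  map-length-shift : ∀ (w : ℕ → ℕ) Cs → map (w ∘ length) (map (map suc) Cs) ≡ map (w ∘ length) Cs
  map-length-shift w Cs = trans (sym (map-∘ Cs)) (map-cong (cong w ∘ length-map suc) Cs)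

  palindromePairs-size : ∀ s → product (map (λ C → 2 ^ length C) (palindromePairs s)) ≡ 2 ^ s
  palindromePairs-size zero          = refl
  palindromePairs-size (suc zero)    = refl
  palindromePairs-size (suc (suc s)) = begin
    4 * product (map (λ C → 2 ^ length C) (map (map suc) (palindromePairs s)))
      ≡⟨ cong (λ ws → 4 * product ws) (map-length-shift (2 ^_) (palindromePairs s)) ⟩
    4 * product (map (λ C → 2 ^ length C) (palindromePairs s))
      ≡⟨ cong (4 *_) (palindromePairs-size s) ⟩
    4 * 2 ^ s
      ≡⟨ *-assoc 2 2 (2 ^ s) ⟩
    2 ^ suc (suc s)
      ∎
    where open ≡-Reasoning

  palindromePairs-avoid : ∀ s → product (map (λ C → 2 ^ length C ∸ 1) (palindromePairs s)) ≡ 3 ^ ⌊ s /2⌋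
  palindromePairs-avoid zero          = refl
  palindromePairs-avoid (suc zero)    = refl
  palindromePairs-avoid (suc (suc s)) = cong (3 *_) (begin
    product (map (λ C → 2 ^ length C ∸ 1) (map (map suc) (palindromePairs s)))
      ≡⟨ cong product (map-length-shift (λ k → 2 ^ k ∸ 1) (palindromePairs s)) ⟩
    product (map (λ C → 2 ^ length C ∸ 1) (palindromePairs s))
      ≡⟨ palindromePairs-avoid s ⟩
    3 ^ ⌊ s /2⌋
      ∎)
    where open ≡-Reasoning

  targetClauses : ℕ → List ℕ → List (List ℕ)
  targetClauses s S = map [_] S ++ palindromePairs s

  count-targetClauses : ∀ m s S → s ≤ m → Unique S → All (λ c → s ≤ c × c < m) S →
    2 ^ length S * 2 ^ s * count m (λ R → avoidsAll R (targetClauses s S)) ≡ 2 ^ m * 3 ^ ⌊ s /2⌋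
  count-targetClauses m s S s≤m uS S-range = begin
    2 ^ length S * 2 ^ s * count m (λ R → avoidsAll R Cs)
      ≡⟨ cong (_* count m (λ R → avoidsAll R Cs)) sizes ⟨
    product (map (λ C → 2 ^ length C) Cs) * count m (λ R → avoidsAll R Cs)
      ≡⟨ count-avoidsAll m Cs unique disjoint bounded ⟩
    2 ^ m * product (map (λ C → 2 ^ length C ∸ 1) Cs)
      ≡⟨ cong (2 ^ m *_) avoid ⟩
    2 ^ m * 3 ^ ⌊ s /2⌋
      ∎
    where
    open ≡-Reasoning
    Cs = targetClauses s S
    product-map-++ : ∀ (f : List ℕ → ℕ) xs ys →
      product (map f (xs ++ ys)) ≡ product (map f xs) * product (map f ys)
    product-map-++ f xs ys = trans (cong product (map-++ f xs ys)) (product-++ (map f xs) (map f ys))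
    singletons-size : ∀ S → product (map (λ C → 2 ^ length C) (map [_] S)) ≡ 2 ^ length S
    singletons-size []      = refl
    singletons-size (c ∷ S) = cong (2 *_) (singletons-size S)
    singletons-avoid : ∀ S → product (map (λ C → 2 ^ length C ∸ 1) (map [_] S)) ≡ 1
    singletons-avoid []      = refl
    singletons-avoid (c ∷ S) = trans (+-identityʳ _) (singletons-avoid S)
    sizes : product (map (λ C → 2 ^ length C) Cs) ≡ 2 ^ length S * 2 ^ s
    sizes = trans (product-map-++ _ (map [_] S) (palindromePairs s))
                  (cong₂ _*_ (singletons-size S) (palindromePairs-size s))
    avoid : product (map (λ C → 2 ^ length C ∸ 1) Cs) ≡ 3 ^ ⌊ s /2⌋
    avoid = trans (product-map-++ _ (map [_] S) (palindromePairs s))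
                   (trans (cong₂ _*_ (singletons-avoid S) (palindromePairs-avoid s)) (*-identityˡ _))
    unique : All Unique Cs
    unique = All.++⁺ (All.map⁺ (All.universal (λ _ → [] ∷ []) S)) (palindromePairs-unique s)
    singletons-pairs-disjoint : All (λ C → All (Disjoint C) (palindromePairs s)) (map [_] S)
    singletons-pairs-disjoint = All.map⁺ (All.map (λ (s≤c , _) → All.map (λ where
      C<s (here refl , v∈C) → <⇒≱ (All.lookup C<s v∈C) s≤c) (palindromePairs-< s)) S-range)
    disjoint : AllPairs Disjoint Cs
    disjoint = AllPairs.++⁺
      (AllPairs.map⁺ (AllPairs.map (λ where c≢c′ (here refl , here refl) → c≢c′ refl) uS))
      (palindromePairs-disjoint s)
      singletons-pairs-disjoint
    bounded : All (All (_< m)) Cs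
    bounded = All.++⁺ (All.map⁺ (All.map (λ (_ , c<m) → c<m ∷ []) S-range))
                      (All.map (All.map (λ c<s → <-≤-trans c<s s≤m)) (palindromePairs-< s))

  Misses : List ℕ → ℕ → Set
  Misses A t = ∀ {x y} → x ∈ A → y ∈ A → x + y ≢ t

  -- e c is the element of A that coordinate c of R stands for.
  avoids-targetClauses : ∀ {m A t s} S (R : Vec Bool m) (e : ℕ → ℕ) → Misses A t →
    (∀ c → T (bit R c) → e c ∈ A) →
    (∀ q q′ → suc (q + q′) ≡ s → e q + e q′ ≡ t) →
    (∀ {c} → c ∈ S → ∃ λ x → x ∈ A × x + e c ≡ t) →
    T (avoidsAll R (targetClauses s S))
  avoids-targetClauses {s = s} S R e misses inA pair-sum single-partner =
    all⁺ (All.++⁺ (All.map⁺ (All.tabulate single-avoided)) (All.tabulate pair-avoided))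
    where
    pair-avoided : ∀ {C} → C ∈ palindromePairs s → T (not (hits R C))
    pair-avoided {C} C∈pairs with palindromePairs-sum s C∈pairs
    ... | q , q′ , q∈C , q′∈C , 1+q+q′≡s = T-not λ hit →
      let bits = all⁻ {p = bit R} C hit in
      misses (inA q (All.lookup bits q∈C)) (inA q′ (All.lookup bits q′∈C)) (pair-sum q q′ 1+q+q′≡s)
    single-avoided : ∀ {c} → c ∈ S → T (not (hits R [ c ]))
    single-avoided {c} c∈S with single-partner c∈S
    ... | x , x∈A , x+ec≡t = T-not λ hit →
      misses x∈A (inA c (All.lookup (all⁻ {p = bit R} [ c ] hit) (here refl))) x+ec≡t

  -- The geometric series

  n<6*n : ∀ {n} → 0 < n → n < 6 * n
  n<6*n {suc n} _ = m<m+n (suc n) (s≤s z≤n)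

  -- The weights 3^⌊s/2⌋ / 2^s sum to 6: the first two are 1 and 1/2, and each later one is
  -- 3/4 of the weight two places before.
  geometric-bound : ∀ N (f : ℕ → ℕ) c X → 0 < X →
    (∀ s → s < N → c * 2 ^ s * f s ≤ X * 3 ^ ⌊ s /2⌋) →
    c * sum (applyUpTo f N) < 6 * X
  geometric-bound zero          f c X X>0 _     = ≤-<-trans (≤-reflexive (*-zeroʳ c)) (<-trans X>0 (n<6*n X>0))
  geometric-bound (suc zero)    f c X X>0 bound = begin-strict
    c * (f 0 + 0)  ≡⟨ reshape c (f 0) ⟩
    c * 1 * f 0    ≤⟨ bound 0 (s≤s z≤n) ⟩
    X * 1          ≡⟨ *-identityʳ X ⟩
    X              <⟨ n<6*n X>0 ⟩
    6 * X          ∎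
    where
    open ≤-Reasoning
    reshape : ∀ c x → c * (x + 0) ≡ c * 1 * x
    reshape = solve-∀
  geometric-bound (suc (suc N)) f c X X>0 bound =
    *-cancelˡ-< 4 (c * sum (applyUpTo f (2 + N))) (6 * X) (begin-strict
    4 * (c * (f 0 + (f 1 + Σ′)))
      ≡⟨ split c (f 0) (f 1) Σ′ ⟩
    4 * (c * 1 * f 0) + 2 * (c * 2 * f 1) + 4 * c * Σ′
      <⟨ +-mono-≤-< (+-mono-≤ (*-monoʳ-≤ 4 (bound 0 (s≤s z≤n))) (*-monoʳ-≤ 2 (bound 1 (s≤s (s≤s z≤n)))))
                     (geometric-bound N (f ∘ suc ∘ suc) (4 * c) (3 * X) (*-monoʳ-< 3 X>0) shifted) ⟩
    4 * (X * 1) + 2 * (X * 1) + 6 * (3 * X)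
      ≡⟨ total X ⟩
    4 * (6 * X)
      ∎)
    where
    open ≤-Reasoning
    Σ′ = sum (applyUpTo (f ∘ suc ∘ suc) N)
    shifted : ∀ s → s < N → 4 * c * 2 ^ s * f (2 + s) ≤ 3 * X * 3 ^ ⌊ s /2⌋
    shifted s s<N = subst₂ _≤_ (pow2 c (2 ^ s) (f (2 + s))) (pow3 X (3 ^ ⌊ s /2⌋)) (bound (2 + s) (s≤s (s≤s s<N)))
      where
      pow2 : ∀ c p x → c * (2 * (2 * p)) * x ≡ 4 * c * p * x
      pow2 = solve-∀
      pow3 : ∀ X q → X * (3 * q) ≡ 3 * X * q
      pow3 = solve-∀
    split : ∀ c a b r → 4 * (c * (a + (b + r))) ≡ 4 * (c * 1 * a) + 2 * (c * 2 * b) + 4 * c * r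
    split = solve-∀
    total : ∀ X → 4 * (X * 1) + 2 * (X * 1) + 6 * (3 * X) ≡ 4 * (6 * X)
    total = solve-∀

  applyUpTo-reflect : ∀ (f : ℕ → ℕ) N → applyUpTo (λ i → f (N ∸ suc i)) N ≡ applyDownFrom f N
  applyUpTo-reflect f zero    = refl
  applyUpTo-reflect f (suc N) = cong (f N ∷_) (applyUpTo-reflect f N)

  sum-applyUpTo-reflect : ∀ (f : ℕ → ℕ) N → sum (applyUpTo (λ i → f (N ∸ suc i)) N) ≡ sum (applyUpTo f N)
  sum-applyUpTo-reflect f N = begin
    sum (applyUpTo (λ i → f (N ∸ suc i)) N) ≡⟨ cong sum (applyUpTo-reflect f N) ⟩
    sum (applyDownFrom f N)                 ≡⟨ cong sum (reverse-applyUpTo f N) ⟨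
    sum (List.reverse (applyUpTo f N))      ≡⟨ sum-↭ (↭-reverse (applyUpTo f N)) ⟩
    sum (applyUpTo f N)                     ∎
    where open ≡-Reasoning

  bit⇒∈elemsFrom : ∀ {k} off (V : Vec Bool k) b → T (bit V b) → off + b ∈ elemsFrom off V
  bit⇒∈elemsFrom off (true  ∷ V) zero    _ = here (+-identityʳ off)
  bit⇒∈elemsFrom off (true  ∷ V) (suc b) t =
    there (subst (_∈ elemsFrom (suc off) V) (sym (+-suc off b)) (bit⇒∈elemsFrom (suc off) V b t))
  bit⇒∈elemsFrom off (false ∷ V) (suc b) t =
    subst (_∈ elemsFrom (suc off) V) (sym (+-suc off b)) (bit⇒∈elemsFrom (suc off) V b t)

  ∈elemsFrom⇒bit : ∀ {k} off (V : Vec Bool k) {c} → c ∈ elemsFrom off V → ∃ λ b → c ≡ off + b × T (bit V b)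
  ∈elemsFrom⇒bit off (true ∷ V) (here refl) = 0 , sym (+-identityʳ off) , _
  ∈elemsFrom⇒bit off (true ∷ V) (there c∈) =
    let b , c≡ , t = ∈elemsFrom⇒bit (suc off) V c∈ in suc b , trans c≡ (sym (+-suc off b)) , t
  ∈elemsFrom⇒bit off (false ∷ V) c∈ =
    let b , c≡ , t = ∈elemsFrom⇒bit (suc off) V c∈ in suc b , trans c≡ (sym (+-suc off b)) , t

  elemsFrom-unique : ∀ {k} off (V : Vec Bool k) → Unique (elemsFrom off V)
  elemsFrom-unique off []          = []
  elemsFrom-unique off (true  ∷ V) = All.tabulate off∉ ∷ elemsFrom-unique (suc off) V
    where
    off∉ : ∀ {c} → c ∈ elemsFrom (suc off) V → off ≢ c
    off∉ c∈ with ∈elemsFrom⇒bit (suc off) V c∈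
    ... | b , refl , _ = m≢1+m+n off
  elemsFrom-unique off (false ∷ V) = elemsFrom-unique (suc off) V

  length-elemsFrom : ∀ {k} off (V : Vec Bool k) → length (elemsFrom off V) ≡ ∣ V ∣
  length-elemsFrom off []          = refl
  length-elemsFrom off (true  ∷ V) = cong suc (length-elemsFrom (suc off) V)
  length-elemsFrom off (false ∷ V) = length-elemsFrom (suc off) V

  elemsFrom-range : ∀ {k} off (V : Vec Bool k) → All (λ c → off ≤ c × c < off + k) (elemsFrom off V)
  elemsFrom-range {k} off V = All.tabulate λ c∈ → let b , c≡off+b , bit-b = ∈elemsFrom⇒bit off V c∈ in
    subst (λ c → off ≤ c × c < off + k) (sym c≡off+b) (m≤m+n off b , +-monoʳ-< off (bit⇒< V b bit-b))

  targetClauses-bound : ∀ m s {k} (V : Vec Bool k) (P : Vec Bool m → Bool) → s + k ≤ m →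
    (∀ R → T (P R) → T (avoidsAll R (targetClauses s (elemsFrom s V)))) →
    2 ^ ∣ V ∣ * 2 ^ s * count m P ≤ 2 ^ m * 3 ^ ⌊ s /2⌋
  targetClauses-bound m s V P s+k≤m P⇒avoids = begin
    2 ^ ∣ V ∣ * 2 ^ s * count m P
      ≡⟨ cong (λ k → 2 ^ k * 2 ^ s * count m P) (length-elemsFrom s V) ⟨
    2 ^ length S * 2 ^ s * count m P
      ≤⟨ *-monoʳ-≤ (2 ^ length S * 2 ^ s) (count-mono m P⇒avoids) ⟩
    2 ^ length S * 2 ^ s * count m (λ R → avoidsAll R (targetClauses s S))
      ≡⟨ count-targetClauses m s S (≤-trans (m≤m+n s _) s+k≤m) (elemsFrom-unique s V)
           (All.map (λ (s≤c , c<s+k) → s≤c , <-≤-trans c<s+k s+k≤m) (elemsFrom-range s V)) ⟩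
    2 ^ m * 3 ^ ⌊ s /2⌋
      ∎
    where
    open ≤-Reasoning
    S = elemsFrom s V

  ∣∷ʳ∣ : ∀ {k} (V : Vec Bool k) b → ∣ V ∷ʳ b ∣ ≡ ∣ b ∷ V ∣
  ∣∷ʳ∣ []          b     = refl
  ∣∷ʳ∣ (true  ∷ V) true  = cong suc (∣∷ʳ∣ V true)
  ∣∷ʳ∣ (true  ∷ V) false = cong suc (∣∷ʳ∣ V false)
  ∣∷ʳ∣ (false ∷ V) true  = ∣∷ʳ∣ V true
  ∣∷ʳ∣ (false ∷ V) false = ∣∷ʳ∣ V false

  ∣reverse∣ : ∀ {k} (V : Vec Bool k) → ∣ reverse V ∣ ≡ ∣ V ∣
  ∣reverse∣ []      = refl
  ∣reverse∣ (b ∷ V) = trans (cong ∣_∣ (reverse-∷ b V)) (trans (∣∷ʳ∣ (reverse V) b) (cons b))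
    where
    cons : ∀ b → ∣ b ∷ reverse V ∣ ≡ ∣ b ∷ V ∣
    cons true  = cong suc (∣reverse∣ V)
    cons false = ∣reverse∣ V

  inSumset-∈ : ∀ {A x y} → x ∈ A → y ∈ A → T (inSumset A (ℤ.+ (x + y)))
  inSumset-∈ x∈A y∈A = any⁺ x∈A (any⁺ y∈A (fromWitness refl))

  inSumset⇒Misses : ∀ {A t} → T (not (inSumset A (ℤ.+ t))) → Misses A t
  inSumset⇒Misses t∉A+A x∈A y∈A refl = T-not⁻ t∉A+A (inSumset-∈ x∈A y∈A)

  all-++ : ∀ {A : Set} (p : A → Bool) xs ys → all p (xs ++ ys) ≡ all p xs ∧ all p ys
  all-++ p []       ys = refl
  all-++ p (x ∷ xs) ys = trans (cong (p x ∧_) (all-++ p xs ys)) (sym (∧-assoc (p x) _ _))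

  count-not-all : ∀ m {A : Set} (F : Vec Bool m → A → Bool) xs →
    count m (λ R → not (all (F R) xs)) ≤ sum (map (λ x → count m (λ R → not (F R x))) xs)
  count-not-all m F []       = ≤-reflexive (count-false m)
  count-not-all m F (x ∷ xs) = ≤-trans (count-not-∧ m (λ R → F R x) (λ R → all (F R) xs))
                                       (+-monoʳ-≤ (count m (λ R → not (F R x))) (count-not-all m F xs))

  count-not-all-intervalZ : ∀ m (F : Vec Bool m → ℤ → Bool) lo hi →
    count m (λ R → not (all (F R) (intervalZ lo hi)))
      ≤ sum (applyUpTo (λ i → count m (λ R → not (F R (ℤ.+ (lo + i) ℤ.- ℤ.+ 1)))) (suc hi ∸ lo))
  count-not-all-intervalZ m F lo hi = ≤-trans (count-not-all m F (intervalZ lo hi)) (≤-reflexive (cong sum (begin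
    map h (map g (upTo N)) ≡⟨ map-∘ (upTo N) ⟨
    map (h ∘ g) (upTo N)   ≡⟨ map-upTo (h ∘ g) N ⟩
    applyUpTo (h ∘ g) N    ∎)))
    where
    open ≡-Reasoning
    N = suc hi ∸ lo
    g = λ i → ℤ.+ (lo + i) ℤ.- ℤ.+ 1
    h = λ z → count m (λ R → not (F R z))

  positive-pred : ∀ {k} → 0 < k → ∃ λ t → ℤ.+ k ℤ.- ℤ.+ 1 ≡ ℤ.+ t × suc t ≡ k
  positive-pred {suc t} _ = t , refl , refl

  <∸⇒+< : ∀ {s a b} → s < a ∸ b → s + b < a
  <∸⇒+< {s} {a} {b} s<a∸b with b ≤? a
  ... | yes b≤a = m≤o∸n⇒m+n≤o (suc s) b≤a s<a∸b
  ... | no  b≰a = ⊥-elim (n≮0 (subst (s <_) (m≤n⇒m∸n≡0 (<⇒≤ (≰⇒> b≰a))) s<a∸b))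

  lower-pair-sum : ∀ {ℓ q q′ t} → suc t ≡ 2 * ℓ + suc (q + q′) → ℓ + q + (ℓ + q′) ≡ t
  lower-pair-sum {ℓ} {q} {q′} 1+t≡ = suc-injective (trans (arith ℓ q q′) (sym 1+t≡))
    where
    arith : ∀ ℓ q q′ → suc (ℓ + q + (ℓ + q′)) ≡ 2 * ℓ + suc (q + q′)
    arith = solve-∀

  lower-single-sum : ∀ {ℓ b x s t} → suc (b + x) ≡ ℓ → suc t ≡ 2 * ℓ + s → x + (ℓ + (s + b)) ≡ t
  lower-single-sum {b = b} {x} {s} refl 1+t≡ = suc-injective (trans (arith b x s) (sym 1+t≡))
    where
    arith : ∀ b x s → suc (x + (suc (b + x) + (s + b))) ≡ 2 * suc (b + x) + s
    arith = solve-∀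

  reflect-coordinate : ∀ {ℓ m c} → c < m → suc (c + (ℓ + (m ∸ suc c))) ≡ ℓ + m
  reflect-coordinate {ℓ} {m} {c} c<m = begin
    suc (c + (ℓ + (m ∸ suc c))) ≡⟨ arith c ℓ (m ∸ suc c) ⟩
    ℓ + (suc c + (m ∸ suc c))   ≡⟨ cong (ℓ +_) (m+[n∸m]≡n c<m) ⟩
    ℓ + m                       ∎
    where
    open ≡-Reasoning
    arith : ∀ c ℓ y → suc (c + (ℓ + y)) ≡ ℓ + (suc c + y)
    arith = solve-∀

  reflected-pair-sum : ∀ {K q q′ x x′ t} → suc (q + x) ≡ K → suc (q′ + x′) ≡ K →
    suc (suc (q + q′) + t) ≡ K + K → x + x′ ≡ t
  reflected-pair-sum {q = q} {q′} {x} {x′} refl e′ e = +-cancelˡ-≡ (2 + (q + q′)) _ _ (begin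
    2 + (q + q′) + (x + x′)        ≡⟨ arith q q′ x x′ ⟩
    suc (q + x) + suc (q′ + x′)    ≡⟨ cong (suc (q + x) +_) e′ ⟩
    suc (q + x) + suc (q + x)      ≡⟨ e ⟨
    2 + (q + q′) + _               ∎)
    where
    open ≡-Reasoning
    arith : ∀ q q′ x x′ → 2 + (q + q′) + (x + x′) ≡ suc (q + x) + suc (q′ + x′)
    arith = solve-∀

  reflected-single-sum : ∀ {K s b y t} → suc (s + b + y) ≡ K → suc (s + t) ≡ K + K → K + b + y ≡ t
  reflected-single-sum {K} {s} {b} {y} e e′ = +-cancelˡ-≡ (suc s) _ _ (begin
    suc s + (K + b + y)   ≡⟨ arith s K b y ⟩
    K + suc (s + b + y)   ≡⟨ cong (K +_) e ⟩
    K + K                 ≡⟨ e′ ⟨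
    suc s + _             ∎)
    where
    open ≡-Reasoning
    arith : ∀ s K b y → suc s + (K + b + y) ≡ K + suc (s + b + y)
    arith = solve-∀

  -- Rational arithmetic

  cross-multiplied : ∀ {A B X g bad} → g + bad ≡ X → bad * A < B * X →
    (A ℤ.⊖ B) ℤ.* ℤ.+ X ℤ.< ℤ.+ g ℤ.* ℤ.+ A
  cross-multiplied {A} {B} {_} {g} {bad} refl bad*A<B*X = begin-strict
    (A ℤ.⊖ B) ℤ.* ℤ.+ X                    ≡⟨ cong (ℤ._* ℤ.+ X) (ℤ.[+m]-[+n]≡m⊖n A B) ⟨
    (ℤ.+ A ℤ.- ℤ.+ B) ℤ.* ℤ.+ X            ≡⟨ expand (ℤ.+ A) (ℤ.+ B) (ℤ.+ X) ⟩
    ℤ.+ A ℤ.* ℤ.+ X ℤ.- ℤ.+ B ℤ.* ℤ.+ X    ≡⟨ cong₂ ℤ._-_ (ℤ.pos-* A X) (ℤ.pos-* B X) ⟨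
    ℤ.+ (A * X) ℤ.- ℤ.+ (B * X)            <⟨ ℤ.+-monoˡ-< (ℤ.- ℤ.+ (B * X)) (ℤ.+<+ A*X<g*A+B*X) ⟩
    ℤ.+ (g * A + B * X) ℤ.- ℤ.+ (B * X)    ≡⟨ cong (ℤ._- ℤ.+ (B * X)) (ℤ.pos-+ (g * A) (B * X)) ⟩
    ℤ.+ (g * A) ℤ.+ ℤ.+ (B * X) ℤ.- ℤ.+ (B * X) ≡⟨ cancel (ℤ.+ (g * A)) (ℤ.+ (B * X)) ⟩
    ℤ.+ (g * A)                            ≡⟨ ℤ.pos-* g A ⟩
    ℤ.+ g ℤ.* ℤ.+ A                        ∎
    where
    open ℤ.≤-Reasoning
    X = g + bad
    A*X<g*A+B*X : A * X < g * A + B * X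
    A*X<g*A+B*X = subst (_< g * A + B * X) (sym (distrib A g bad)) (+-monoʳ-< (g * A) bad*A<B*X)
      where
      distrib : ∀ A g bad → A * (g + bad) ≡ g * A + bad * A
      distrib = solve-∀
    expand : ∀ a b x → (a ℤ.- b) ℤ.* x ≡ a ℤ.* x ℤ.- b ℤ.* x
    expand = ℤ.solve-∀
    cancel : ∀ c d → c ℤ.+ d ℤ.- d ≡ c
    cancel = ℤ.solve-∀

  union-of-sides : ∀ {bad B₁ B₂ p q X} .{{_ : NonZero p}} .{{_ : NonZero q}} →
    bad ≤ B₁ + B₂ → p * B₁ < 6 * X → q * B₂ < 6 * X → bad * (p * q) < 6 * (q + p) * X
  union-of-sides {bad} {B₁} {B₂} {p} {q} {X} bad≤B₁+B₂ pB₁<6X qB₂<6X = begin-strict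
    bad * (p * q)                  ≤⟨ *-monoˡ-≤ (p * q) bad≤B₁+B₂ ⟩
    (B₁ + B₂) * (p * q)            ≡⟨ spread B₁ B₂ p q ⟩
    q * (p * B₁) + p * (q * B₂)    <⟨ +-mono-< (*-monoʳ-< q pB₁<6X) (*-monoʳ-< p qB₂<6X) ⟩
    q * (6 * X) + p * (6 * X)      ≡⟨ collect q p X ⟩
    6 * (q + p) * X                ∎
    where
    open ≤-Reasoning
    spread : ∀ B₁ B₂ p q → (B₁ + B₂) * (p * q) ≡ q * (p * B₁) + p * (q * B₂)
    spread = solve-∀
    collect : ∀ q p X → q * (6 * X) + p * (6 * X) ≡ 6 * (q + p) * X
    collect = solve-∀

  -- The left-hand side has denominator A and numerator A ⊖ B exactly as ℚᵘ arithmetic computes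
  -- them, so *<* applies to cross-multiplied without rewriting.
  ℚᵘ-bound : ∀ da db dx g bad → g + bad ≡ suc dx →
    bad * (suc da * suc db) < 6 * (suc db + suc da) * suc dx →
    ℚᵘ.1ℚᵘ ℚᵘ.- ℚᵘ.mkℚᵘ (ℤ.+ 6) 0 ℚᵘ.* (ℚᵘ.mkℚᵘ (ℤ.+ 1) da ℚᵘ.+ ℚᵘ.mkℚᵘ (ℤ.+ 1) db)
      ℚᵘ.< ℚᵘ.mkℚᵘ (ℤ.+ g) dx
  ℚᵘ-bound da db dx g bad g+bad≡X bad*D<6S*X = ℚᵘ.*<* (cross-multiplied {A} {B} {suc dx} {g} {bad} g+bad≡X
    (subst₂ (λ D S → bad * D < S * suc dx) (denominator (suc da) (suc db)) (numerator (suc da) (suc db))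
      bad*D<6S*X))
    where
    A = 1 * (1 * (suc da * suc db))
    B = 6 * (1 * suc db + 1 * suc da) * 1
    denominator : ∀ x y → x * y ≡ 1 * (1 * (x * y))
    denominator = solve-∀
    numerator : ∀ x y → 6 * (y + x) ≡ 6 * (1 * y + 1 * x) * 1
    numerator = solve-∀

  toℚᵘ-/ : ∀ i d .{{_ : NonZero d}} → ℚ.toℚᵘ (i ℚ./ d) ℚᵘ.≃ ℚᵘ.mkℚᵘ i (pred d)
  toℚᵘ-/ i (suc d) = ℚ.toℚᵘ-fromℚᵘ (ℚᵘ.mkℚᵘ i d)

  probability-bound : ∀ a b m g bad → g + bad ≡ 2 ^ m →
    bad * (2 ^ a * 2 ^ b) < 6 * (2 ^ b + 2 ^ a) * 2 ^ m →
    ℚ.1ℚ ℚ.- (ℤ.+ 6 ℚ./ 1) ℚ.* (inv2^ a ℚ.+ inv2^ b) ℚ.< ℚ._/_ (ℤ.+ g) (2 ^ m) {{m^n≢0 2 m}}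
  probability-bound a b m g bad g+bad≡X bad*D<6S*X = ℚ.toℚᵘ-cancel-<
    (ℚᵘ.<-respʳ-≃ (ℚᵘ.≃-sym (toℚᵘ-/ (ℤ.+ g) (2 ^ m))) (ℚᵘ.<-respˡ-≃ (ℚᵘ.≃-sym lhs≃) boundᵘ))
    where
    instance
      _ = m^n≢0 2 a
      _ = m^n≢0 2 b
      _ = m^n≢0 2 m
    boundᵘ = ℚᵘ-bound (pred (2 ^ a)) (pred (2 ^ b)) (pred (2 ^ m)) g bad
      (trans g+bad≡X (sym (suc-pred (2 ^ m))))
      (subst₂ (λ D S → bad * D < S) (sym (cong₂ _*_ (suc-pred (2 ^ a)) (suc-pred (2 ^ b))))
        (sym (cong₂ (λ S X → 6 * S * X) (cong₂ _+_ (suc-pred (2 ^ b)) (suc-pred (2 ^ a))) (suc-pred (2 ^ m))))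
        bad*D<6S*X)
    six = ℤ.+ 6 ℚ./ 1
    s = inv2^ a ℚ.+ inv2^ b
    sᵘ = ℚᵘ.mkℚᵘ (ℤ.+ 1) (pred (2 ^ a)) ℚᵘ.+ ℚᵘ.mkℚᵘ (ℤ.+ 1) (pred (2 ^ b))
    s≃ : ℚ.toℚᵘ s ℚᵘ.≃ sᵘ
    s≃ = ℚᵘ.≃-trans (ℚ.toℚᵘ-homo-+ (inv2^ a) (inv2^ b))
                    (ℚᵘ.+-cong (toℚᵘ-/ (ℤ.+ 1) (2 ^ a)) (toℚᵘ-/ (ℤ.+ 1) (2 ^ b)))
    lhs≃ : ℚ.toℚᵘ (ℚ.1ℚ ℚ.- six ℚ.* s) ℚᵘ.≃ ℚᵘ.1ℚᵘ ℚᵘ.- ℚᵘ.mkℚᵘ (ℤ.+ 6) 0 ℚᵘ.* sᵘ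
    lhs≃ = ℚᵘ.≃-trans (ℚ.toℚᵘ-homo-+ ℚ.1ℚ (ℚ.- (six ℚ.* s))) (ℚᵘ.+-cong ℚᵘ.≃-refl
      (ℚᵘ.≃-trans (ℚ.toℚᵘ-homo‿- (six ℚ.* s)) (ℚᵘ.-‿cong
        (ℚᵘ.≃-trans (ℚ.toℚᵘ-homo-* six s) (ℚᵘ.*-cong ℚᵘ.≃-refl s≃)))))

  -- The random set A = L ∪ R ∪ U

  module Configuration (n ℓ u : ℕ) (ℓ+u≤n : ℓ + u ≤ n) (L : Subset ℓ) (U : Subset u) where

    m : ℕ
    m = n ∸ ℓ ∸ u

    A : Vec Bool m → List ℕ
    A R = setA n ℓ u L R U

    n≡ℓ+u+m : n ≡ ℓ + u + m
    n≡ℓ+u+m = begin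
      n                      ≡⟨ m+[n∸m]≡n ℓ+u≤n ⟨
      ℓ + u + (n ∸ (ℓ + u))  ≡⟨ cong (ℓ + u +_) (∸-+-assoc n ℓ u) ⟨
      ℓ + u + m              ∎
      where open ≡-Reasoning

    n∸u≡ℓ+m : n ∸ u ≡ ℓ + m
    n∸u≡ℓ+m = begin
      n ∸ u            ≡⟨ cong (_∸ u) (trans n≡ℓ+u+m (arith ℓ u m)) ⟩
      u + (ℓ + m) ∸ u  ≡⟨ m+n∸m≡n u (ℓ + m) ⟩
      ℓ + m            ∎
      where
      open ≡-Reasoning
      arith : ∀ ℓ u m → ℓ + u + m ≡ u + (ℓ + m)
      arith = solve-∀

    ∈A-R : ∀ R c → T (bit R c) → ℓ + c ∈ A R
    ∈A-R R c t = ∈-++⁺ʳ (elemsFrom 0 L) (∈-++⁺ˡ (bit⇒∈elemsFrom ℓ R c t))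

    ∈A-L : ∀ R b → T (bit L b) → b ∈ A R
    ∈A-L R b t = ∈-++⁺ˡ (bit⇒∈elemsFrom 0 L b t)

    ∈A-U : ∀ R b → T (bit U b) → ℓ + m + b ∈ A R
    ∈A-U R b t = ∈-++⁺ʳ (elemsFrom 0 L) (∈-++⁺ʳ (elemsFrom ℓ R)
      (subst (λ k → k + b ∈ elemsFrom (n ∸ u) U) n∸u≡ℓ+m (bit⇒∈elemsFrom (n ∸ u) U b t)))

    misses : ℤ → Vec Bool m → Bool
    misses z R = not (inSumset (A R) z)

    lower-target-bound : ∀ s t → suc t ≡ 2 * ℓ + s → s + ℓ ≤ m →
      2 ^ ∣ L ∣ * 2 ^ s * count m (misses (ℤ.+ t)) ≤ 2 ^ m * 3 ^ ⌊ s /2⌋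
    lower-target-bound s t 1+t≡ s+ℓ≤m =
      subst (λ k → 2 ^ k * 2 ^ s * count m (misses (ℤ.+ t)) ≤ 2 ^ m * 3 ^ ⌊ s /2⌋) (∣reverse∣ L)
        (targetClauses-bound m s (reverse L) (misses (ℤ.+ t)) s+ℓ≤m avoids)
      where
      pair-sum : ∀ q q′ → suc (q + q′) ≡ s → ℓ + q + (ℓ + q′) ≡ t
      pair-sum q q′ 1+q+q′≡s = lower-pair-sum {ℓ} {q} {q′} (trans 1+t≡ (cong (2 * ℓ +_) (sym 1+q+q′≡s)))
      partner : ∀ R {c} → c ∈ elemsFrom s (reverse L) → ∃ λ x → x ∈ A R × x + (ℓ + c) ≡ t
      partner R c∈S with ∈elemsFrom⇒bit s (reverse L) c∈S
      ... | b , refl , bit-b = ℓ ∸ suc b , ∈A-L R _ (subst T (bit-reverse L b b<ℓ) bit-b) ,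
                               lower-single-sum {ℓ} {b} (m+[n∸m]≡n b<ℓ) 1+t≡
        where b<ℓ = bit⇒< (reverse L) b bit-b
      avoids : ∀ R → T (misses (ℤ.+ t) R) → T (avoidsAll R (targetClauses s (elemsFrom s (reverse L))))
      avoids R t∉A+A = avoids-targetClauses _ R (ℓ +_) (inSumset⇒Misses t∉A+A) (∈A-R R) pair-sum (partner R)

    -- Read backwards, coordinate c of R stands for the element mirror c = n - u - 1 - c of A, so an
    -- upper target behaves like a lower one with U in the role of L.
    upper-target-bound : ∀ s t → suc (s + t) ≡ 2 * (n ∸ u) → s + u ≤ m →
      2 ^ ∣ U ∣ * 2 ^ s * count m (misses (ℤ.+ t)) ≤ 2 ^ m * 3 ^ ⌊ s /2⌋
    upper-target-bound s t 1+s+t≡ s+u≤m = begin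
      2 ^ ∣ U ∣ * 2 ^ s * count m (misses (ℤ.+ t))
        ≡⟨ cong (2 ^ ∣ U ∣ * 2 ^ s *_) (count-reverse m (misses (ℤ.+ t))) ⟨
      2 ^ ∣ U ∣ * 2 ^ s * count m (misses (ℤ.+ t) ∘ reverse)
        ≤⟨ targetClauses-bound m s U (misses (ℤ.+ t) ∘ reverse) s+u≤m avoids ⟩
      2 ^ m * 3 ^ ⌊ s /2⌋
        ∎
      where
      open ≤-Reasoning
      K = ℓ + m
      1+s+t≡K+K : suc (s + t) ≡ K + K
      1+s+t≡K+K = trans 1+s+t≡ (trans (cong (2 *_) n∸u≡ℓ+m) (cong (K +_) (+-identityʳ K)))
      mirror : ℕ → ℕ
      mirror c = ℓ + (m ∸ suc c)
      ∈A-mirror : ∀ R c → T (bit R c) → mirror c ∈ A (reverse R)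
      ∈A-mirror R c bit-c = ∈A-R (reverse R) (m ∸ suc c) (subst T bit-mirror bit-c)
        where
        c<m = bit⇒< R c bit-c
        bit-mirror : bit R c ≡ bit (reverse R) (m ∸ suc c)
        bit-mirror = trans (cong (λ R′ → bit R′ c) (sym (reverse-involutive R))) (bit-reverse (reverse R) c c<m)
      pair-sum : ∀ q q′ → suc (q + q′) ≡ s → mirror q + mirror q′ ≡ t
      pair-sum q q′ 1+q+q′≡s =
        reflected-pair-sum {K} {q} {q′} (reflect-coordinate {ℓ} q<m) (reflect-coordinate {ℓ} q′<m)
          (subst (λ s → suc (s + t) ≡ K + K) (sym 1+q+q′≡s) 1+s+t≡K+K)
        where
        s≤m = ≤-trans (m≤m+n s u) s+u≤m
        q<m = <-≤-trans (subst (q <_) 1+q+q′≡s (s≤s (m≤m+n q q′))) s≤m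
        q′<m = <-≤-trans (subst (q′ <_) 1+q+q′≡s (s≤s (m≤n+m q′ q))) s≤m
      partner : ∀ R {c} → c ∈ elemsFrom s U → ∃ λ x → x ∈ A R × x + mirror c ≡ t
      partner R c∈S with ∈elemsFrom⇒bit s U c∈S
      ... | b , refl , bit-b =
        K + b , ∈A-U R b bit-b , reflected-single-sum {K} {s} {b} (reflect-coordinate {ℓ} s+b<m) 1+s+t≡K+K
        where s+b<m = <-≤-trans (+-monoʳ-< s (bit⇒< U b bit-b)) s+u≤m
      avoids : ∀ R → T (misses (ℤ.+ t) (reverse R)) → T (avoidsAll R (targetClauses s (elemsFrom s U)))
      avoids R t∉A+A =
        avoids-targetClauses _ R mirror (inSumset⇒Misses t∉A+A) (∈A-mirror R) pair-sum (partner (reverse R))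

    missesSome : List ℤ → Vec Bool m → Bool
    missesSome zs R = not (all (inSumset (A R)) zs)

    trivial-side-bound : ∀ {k} zs → k ≡ 0 → 2 ^ k * count m (missesSome zs) < 6 * 2 ^ m
    trivial-side-bound zs refl =
      ≤-<-trans (≤-reflexive (+-identityʳ _)) (≤-<-trans (count-≤ m _) (n<6*n (m^n>0 2 m)))

    lowerCount upperCount : ℕ
    lowerCount = suc (n ∸ u) ∸ 2 * ℓ
    upperCount = suc (2 * (n ∸ u)) ∸ (n + ℓ)

    lower-target-index : ℓ ≢ 0 → ∀ s → s < lowerCount →
      ∃ λ t → ℤ.+ (2 * ℓ + s) ℤ.- ℤ.+ 1 ≡ ℤ.+ t × suc t ≡ 2 * ℓ + s × s + ℓ ≤ m
    lower-target-index ℓ≢0 s s<N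
      with positive-pred {2 * ℓ + s} (<-≤-trans (n≢0⇒n>0 ℓ≢0) (≤-trans (m≤m+n ℓ _) (m≤m+n _ s)))
    ... | t , z≡t , 1+t≡ = t , z≡t , 1+t≡ , s+ℓ≤m
      where
      s+2ℓ≤ℓ+m : s + 2 * ℓ ≤ ℓ + m
      s+2ℓ≤ℓ+m = subst (s + 2 * ℓ ≤_) n∸u≡ℓ+m (≤-pred (<∸⇒+< s<N))
      s+ℓ≤m : s + ℓ ≤ m
      s+ℓ≤m = +-cancelʳ-≤ ℓ (s + ℓ) m (subst₂ _≤_ (arith s ℓ) (+-comm ℓ m) s+2ℓ≤ℓ+m)
        where
        arith : ∀ s ℓ → s + 2 * ℓ ≡ s + ℓ + ℓ
        arith = solve-∀

    upper-target-index : u ≢ 0 → ∀ s → s < upperCount →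
      ∃ λ t → ℤ.+ (n + ℓ + (upperCount ∸ suc s)) ℤ.- ℤ.+ 1 ≡ ℤ.+ t × suc (s + t) ≡ 2 * (n ∸ u) × s + u ≤ m
    upper-target-index u≢0 s s<N
      with positive-pred {n + ℓ + (upperCount ∸ suc s)}
             (<-≤-trans (n≢0⇒n>0 u≢0) (≤-trans (≤-trans (m≤n+m u ℓ) ℓ+u≤n) (≤-trans (m≤m+n n ℓ) (m≤m+n _ _))))
    ... | t , z≡t , 1+t≡ = t , z≡t , 1+s+t≡V , s+u≤m
      where
      W = n + ℓ
      V = 2 * (n ∸ u)
      s+W<1+V : s + W < suc V
      s+W<1+V = <∸⇒+< s<N
      1+s+t≡V : suc (s + t) ≡ V
      1+s+t≡V = suc-injective (begin
        suc (suc (s + t))                   ≡⟨ cong suc (trans (sym (+-suc s t)) (cong (s +_) 1+t≡)) ⟩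
        suc (s + (W + (upperCount ∸ suc s))) ≡⟨ arith s W (upperCount ∸ suc s) ⟩
        W + (upperCount ∸ suc s + suc s)     ≡⟨ cong (W +_) (m∸n+n≡m s<N) ⟩
        W + upperCount                       ≡⟨ m+[n∸m]≡n (≤-trans (m≤n+m W s) (<⇒≤ s+W<1+V)) ⟩
        suc V                                ∎)
        where
        open ≡-Reasoning
        arith : ∀ s W i → suc (s + (W + i)) ≡ W + (i + suc s)
        arith = solve-∀
      s+u≤m : s + u ≤ m
      s+u≤m = +-cancelʳ-≤ (ℓ + m + ℓ) (s + u) m (subst₂ _≤_
        (trans (cong (λ n → s + (n + ℓ)) n≡ℓ+u+m) (arith₁ s ℓ u m))
        (trans (cong (2 *_) n∸u≡ℓ+m) (arith₂ ℓ m))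
        (≤-pred s+W<1+V))
        where
        arith₁ : ∀ s ℓ u m → s + (ℓ + u + m + ℓ) ≡ s + u + (ℓ + m + ℓ)
        arith₁ = solve-∀
        arith₂ : ∀ ℓ m → 2 * (ℓ + m) ≡ m + (ℓ + m + ℓ)
        arith₂ = solve-∀

    lower-bound : 2 ^ ∣ L ∣ * count m (missesSome (intervalZ (2 * ℓ) (n ∸ u))) < 6 * 2 ^ m
    -- For ℓ = 0 the first lower target is -1, which no sum hits; then ∣ L ∣ = 0 and the trivial
    -- bound suffices.
    lower-bound with ℓ ≟ 0
    ... | yes ℓ≡0 =
      trivial-side-bound (intervalZ (2 * ℓ) (n ∸ u)) (n≤0⇒n≡0 (≤-trans (∣p∣≤n L) (≤-reflexive ℓ≡0)))
    ... | no  ℓ≢0 = begin-strict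
      2 ^ ∣ L ∣ * count m (missesSome (intervalZ (2 * ℓ) (n ∸ u)))
        ≤⟨ *-monoʳ-≤ (2 ^ ∣ L ∣) (count-not-all-intervalZ m (inSumset ∘ A) (2 * ℓ) (n ∸ u)) ⟩
      2 ^ ∣ L ∣ * sum (applyUpTo f lowerCount)
        <⟨ geometric-bound lowerCount f (2 ^ ∣ L ∣) (2 ^ m) (m^n>0 2 m) bound ⟩
      6 * 2 ^ m
        ∎
      where
      open ≤-Reasoning
      f = λ s → count m (misses (ℤ.+ (2 * ℓ + s) ℤ.- ℤ.+ 1))
      bound : ∀ s → s < lowerCount → 2 ^ ∣ L ∣ * 2 ^ s * f s ≤ 2 ^ m * 3 ^ ⌊ s /2⌋
      bound s s<N with lower-target-index ℓ≢0 s s<N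
      ... | t , z≡t , 1+t≡ , s+ℓ≤m =
        subst (λ z → 2 ^ ∣ L ∣ * 2 ^ s * count m (misses z) ≤ 2 ^ m * 3 ^ ⌊ s /2⌋) (sym z≡t)
          (lower-target-bound s t 1+t≡ s+ℓ≤m)

    upper-bound : 2 ^ ∣ U ∣ * count m (missesSome (intervalZ (n + ℓ) (2 * (n ∸ u)))) < 6 * 2 ^ m
    -- For u > 0 also n > 0, so the upper targets n + ℓ - 1 + i are natural numbers.
    upper-bound with u ≟ 0
    ... | yes u≡0 =
      trivial-side-bound (intervalZ (n + ℓ) (2 * (n ∸ u))) (n≤0⇒n≡0 (≤-trans (∣p∣≤n U) (≤-reflexive u≡0)))
    ... | no  u≢0 = begin-strict
      2 ^ ∣ U ∣ * count m (missesSome (intervalZ (n + ℓ) (2 * (n ∸ u))))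
        ≤⟨ *-monoʳ-≤ (2 ^ ∣ U ∣) (count-not-all-intervalZ m (inSumset ∘ A) (n + ℓ) (2 * (n ∸ u))) ⟩
      2 ^ ∣ U ∣ * sum (applyUpTo g upperCount)
        ≡⟨ cong (2 ^ ∣ U ∣ *_) (sum-applyUpTo-reflect g upperCount) ⟨
      2 ^ ∣ U ∣ * sum (applyUpTo (λ s → g (upperCount ∸ suc s)) upperCount)
        <⟨ geometric-bound upperCount (λ s → g (upperCount ∸ suc s)) (2 ^ ∣ U ∣) (2 ^ m) (m^n>0 2 m) bound ⟩
      6 * 2 ^ m
        ∎
      where
      open ≤-Reasoning
      g = λ i → count m (misses (ℤ.+ (n + ℓ + i) ℤ.- ℤ.+ 1))
      bound : ∀ s → s < upperCount → 2 ^ ∣ U ∣ * 2 ^ s * g (upperCount ∸ suc s) ≤ 2 ^ m * 3 ^ ⌊ s /2⌋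
      bound s s<N with upper-target-index u≢0 s s<N
      ... | t , z≡t , 1+s+t≡V , s+u≤m =
        subst (λ z → 2 ^ ∣ U ∣ * 2 ^ s * count m (misses z) ≤ 2 ^ m * 3 ^ ⌊ s /2⌋) (sym z≡t)
          (upper-target-bound s t 1+s+t≡V s+u≤m)

    failures : ℕ
    failures = count m (λ R → not (event n ℓ u L U R))

    failures-≤ : failures
      ≤ count m (missesSome (intervalZ (2 * ℓ) (n ∸ u))) + count m (missesSome (intervalZ (n + ℓ) (2 * (n ∸ u))))
    failures-≤ = ≤-trans
      (≤-reflexive (count-cong m λ R → cong not (all-++ (inSumset (A R)) (intervalZ (2 * ℓ) (n ∸ u)) _)))
      (count-not-∧ m _ _)

    failures-bound : failures * (2 ^ ∣ L ∣ * 2 ^ ∣ U ∣) < 6 * (2 ^ ∣ U ∣ + 2 ^ ∣ L ∣) * 2 ^ m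
    failures-bound = union-of-sides {{m^n≢0 2 ∣ L ∣}} {{m^n≢0 2 ∣ U ∣}} failures-≤ lower-bound upper-bound


open import Defs
open import Data.Nat using (ℕ; _+_; _≤_)
open import Data.Integer using (+_)
open import Data.Rational using (_<_; _-_; _*_; 1ℚ; _/_)
open import Data.Rational using () renaming (_+_ to _+ℚ_)
open import Data.Fin.Subset using (Subset; ∣_∣)
open RandomSumset using (count; count-complement; probability-bound; module Configuration)

proposition8 : (n ℓ u : ℕ) → ℓ + u ≤ n → (L : Subset ℓ) → (U : Subset u) →
    1ℚ - (+ 6 / 1) * (inv2^ ∣ L ∣ +ℚ inv2^ ∣ U ∣) < probability n ℓ u L U
proposition8 n ℓ u ℓ+u≤n L U =
  probability-bound ∣ L ∣ ∣ U ∣ m (count m (event n ℓ u L U)) failures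
    (count-complement m (event n ℓ u L U)) failures-bound
  where open Configuration n ℓ u ℓ+u≤n L U
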